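{- The variety of 0-commutative orthogroupoids is a Church variety with witness term $q(x,y,z)=(x+z)\cdot(x'+y)$ and constants $0,1$; that is, every 0-commutative orthogroupoid satisfies $q(1,x,y)\approx x$ and $q(0,x,y)\approx y$.
   Context: An orthogroupoid is an algebra $\langle D,+,',1\rangle$ of type $(2,1,0)$, with $0:=1'$, satisfying: (a) $x''\approx x$; (b) $0+x\approx x$ and $x+1\approx 1$; (c) $x+x'\approx 1$; (d) for all $x,z$: if $x+z=z$ and $x'+z=z$ then $z=1$; (e) $(((z+y)'+(z+x))'+(z+y)')+z'\approx z'$; (f) $x+(x+y)\approx x+y$ and $y+(x+y)\approx x+y$. It is 0-commutative if it satisfies $x+0\approx 0+x$. Define $x\cdot y:=(x'+y')'$. A variety is a Church variety if there are terms $0,1$ (constants) and a ternary term $q$ such that every member satisfies $q(1,x,y)\approx x$ and $q(0,x,y)\approx y$. -}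

module Defs where

open import Level using (Level; suc; _⊔_)
open import Relation.Binary.PropositionalEquality using (_≡_)

record Orthogroupoid (ℓ : Level) : Set (suc ℓ) where
  infixl 6 _+_
  field
    D    : Set ℓ
    _+_  : D → D → D
    _′   : D → D
    𝟙    : D

  𝟘 : D
  𝟘 = 𝟙 ′

  field
    involutive : ∀ x → (x ′) ′ ≡ x
    0-identityˡ : ∀ x → 𝟘 + x ≡ x
    1-absorbʳ   : ∀ x → x + 𝟙 ≡ 𝟙
    complement  : ∀ x → x + (x ′) ≡ 𝟙
    quasi       : ∀ x z → x + z ≡ z → (x ′) + z ≡ z → z ≡ 𝟙
    axiom-e     : ∀ x y z →
                  ((((z + y) ′ + (z + x)) ′ + (z + y) ′) + z ′) ≡ z ′
    absorbˡ     : ∀ x y → x + (x + y) ≡ x + y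
    absorbʳ     : ∀ x y → y + (x + y) ≡ x + y

  _·_ : D → D → D
  x · y = ((x ′) + (y ′)) ′

  q : D → D → D → D
  q x y z = (x + z) · ((x ′) + y)

Is0Commutative : ∀ {ℓ} → Orthogroupoid ℓ → Set ℓ
Is0Commutative G = ∀ x → x + 𝟘 ≡ 𝟘 + x
  where open Orthogroupoid G

module Submission where

open import Defs
open import Level using (Level)
open import Data.Product using (_×_; _,_)
open import Relation.Binary.PropositionalEquality
  using (_≡_; cong; cong₂; module ≡-Reasoning)
open ≡-Reasoning

module OrthogroupoidProperties {ℓ : Level} (G : Orthogroupoid ℓ) where
  open Orthogroupoid G

  -- Axiom (d) with x = 𝟙: both 𝟙 and 𝟘 are absorbed by 𝟙 + z.
  1-absorbˡ : ∀ z → 𝟙 + z ≡ 𝟙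
  1-absorbˡ z = quasi 𝟙 (𝟙 + z) (absorbˡ 𝟙 z) (0-identityˡ (𝟙 + z))

  ′-𝟘 : 𝟘 ′ ≡ 𝟙
  ′-𝟘 = involutive 𝟙

  ·-identityˡ : ∀ x → 𝟙 · x ≡ x
  ·-identityˡ x = begin
    (𝟘 + x ′) ′ ≡⟨ cong _′ (0-identityˡ (x ′)) ⟩
    x ′ ′       ≡⟨ involutive x ⟩
    x           ∎

  ·-identityʳ : Is0Commutative G → ∀ x → x · 𝟙 ≡ x
  ·-identityʳ 0-comm x = begin
    (x ′ + 𝟘) ′ ≡⟨ cong _′ (0-comm (x ′)) ⟩
    𝟙 · x       ≡⟨ ·-identityˡ x ⟩
    x           ∎

  q-𝟙 : ∀ x y → q 𝟙 x y ≡ x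
  q-𝟙 x y = begin
    (𝟙 + y) · (𝟘 + x) ≡⟨ cong₂ _·_ (1-absorbˡ y) (0-identityˡ x) ⟩
    𝟙 · x             ≡⟨ ·-identityˡ x ⟩
    x                 ∎

  q-𝟘 : Is0Commutative G → ∀ x y → q 𝟘 x y ≡ y
  q-𝟘 0-comm x y = begin
    (𝟘 + y) · (𝟘 ′ + x) ≡⟨ cong₂ _·_ (0-identityˡ y) (cong (_+ x) ′-𝟘) ⟩
    y · (𝟙 + x)         ≡⟨ cong (y ·_) (1-absorbˡ x) ⟩
    y · 𝟙               ≡⟨ ·-identityʳ 0-comm y ⟩
    y                   ∎

proposition3p4 : ∀ {ℓ : Level} (G : Orthogroupoid ℓ) → Is0Commutative G →
    ∀ x y → (Orthogroupoid.q G (Orthogroupoid.𝟙 G) x y ≡ x)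
    × (Orthogroupoid.q G (Orthogroupoid.𝟘 G) x y ≡ y)
proposition3p4 G 0-comm x y = q-𝟙 x y , q-𝟘 0-comm x y
  where open OrthogroupoidProperties G
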